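{- Let $n\ge 2$ be an integer. Suppose that for all integers $m$ and all even integers $k$ with $2\le m\le n$ and $2\le k\le 2^{m-1}+1$, $$v_2(s(2^n,2^m-k)) = 2^n-2^m-(n-m)\Big(2^m-2\Big\lfloor\frac{k}{2}\Big\rfloor\Big) + m-2-v_2\Big(\Big\lfloor\frac{k}{2}\Big\rfloor\Big).$$ Then for any integer $i$ with $1\le i\le 2^{n-1}$, we have $v_2(s(2^n,2i-1))=v_2(s(2^n,2i))+n-1$.
   Context: For nonnegative integers $n,k$, $s(n,k)$ is defined by $x(x+1)\cdots(x+n-1)=\sum_{k=0}^{n}s(n,k)x^k$, with $s(n,k)=0$ for $k>n$. $v_2$ is the 2-adic valuation. -}

module Defs where

open import Data.Nat using (ℕ; zero; suc; _+_; _*_; _^_)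
open import Data.Nat.Divisibility using (_∣_)
open import Data.Product using (_×_)
open import Relation.Nullary using (¬_)

-- Unsigned Stirling numbers of the first kind:
-- x(x+1)...(x+n-1) = Σ_k s(n,k) x^k, via  s(n+1,k) = s(n,k-1) + n * s(n,k).
s : ℕ → ℕ → ℕ
s zero    zero    = 1
s zero    (suc k) = 0
s (suc n) zero    = n * s n zero
s (suc n) (suc k) = s n k + n * s n (suc k)

-- 2-adic valuation, relationally: v₂(m) = e  iff  2^e ∣ m and 2^(e+1) ∤ m.
-- (For m = 0 no e satisfies this, matching that v₂(0) is not a natural number.)
HasV2 : ℕ → ℕ → Set
HasV2 m e = (2 ^ e ∣ m) × ¬ (2 ^ suc e ∣ m)

module Submission where

-- Write n = n₁ + 1, N = 2^n, H = 2^n₁ = N/2 and a_i = v₂(s(N, 2i)).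
-- 1. Polynomials: centring the rising factorial gives x(x+1)⋯(x+N-1) = x · σ(x + H) with
--    σ(y) = y ∏_{i<H} (y² - i²) odd, hence s(N, k+1) = ∑_j σ_j C(j,k) H^(j-k).
-- 2. TwoAdic: exact 2-adic valuations of integers; a sum has the valuation of one term
--    when all other terms are divisible by a strictly higher power of 2.
-- 3. HypothesisBounds: on a dyadic block [2^p, 2^(p+1)) the hypothesis pins
--    a_i + 2^(p+2) + (n₁-p-1)·2i between N and N + p, which yields the gap
--    a_i + 2 ≤ a_(i+1) + 2n₁ and, iterated, a_i + 2d ≤ a_(i+d) + 2n₁d.
-- 4. Dominance: by downward induction on i, v₂(σ_(2i-1)) = a_i, because in the expansion of
--    s(N, 2i) every other term vanishes or is more divisible by the gap estimate; the same
--    estimate shows that the term σ_(2i-1)(2i-1)H, of valuation a_i + n₁, dominates s(N, 2i-1).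
-- The theorem reads off this last valuation.

module Polynomials where

  open import Data.Nat as ℕ using (ℕ; zero; suc; _<_; s≤s)
  import Data.Nat.Properties as ℕₚ
  open import Data.Nat.Combinatorics using (_C_; nCk+nC[k+1]≡[n+1]C[k+1]; k>n⇒nCk≡0)
  open import Data.Integer using (ℤ; +_; _+_; _*_; _-_; -_; 0ℤ; 1ℤ; _^_)
  import Data.Integer.Properties as ℤₚ
  open import Data.Integer.Divisibility.Signed using (_∣_; divides; ∣m∣n⇒∣m+n)
  open import Data.Integer.Tactic.RingSolver using (solve-∀)
  open import Relation.Binary.PropositionalEquality
  open import Relation.Nullary using (yes; no)
  open import Function using (_∘_)
  open import Defs using (s)

  -- A polynomial over ℤ is represented by its coefficient sequence.
  Poly : Set
  Poly = ℕ → ℤ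

  one : Poly
  one zero    = 1ℤ
  one (suc _) = 0ℤ

  mulLin : ℤ → Poly → Poly
  mulLin c p zero    = c * p zero
  mulLin c p (suc k) = p k + c * p (suc k)

  mulLin-cong : ∀ c {p q} → (∀ k → p k ≡ q k) → ∀ k → mulLin c p k ≡ mulLin c q k
  mulLin-cong c p≗q zero    = cong (c *_) (p≗q zero)
  mulLin-cong c p≗q (suc k) = cong₂ (λ x y → x + c * y) (p≗q k) (p≗q (suc k))

  mulLin-comm : ∀ c d p k → mulLin c (mulLin d p) k ≡ mulLin d (mulLin c p) k
  mulLin-comm c d p zero          = swap₁ c d (p 0)
    where swap₁ : ∀ c d x → c * (d * x) ≡ d * (c * x)
          swap₁ = solve-∀
  mulLin-comm c d p (suc zero)    = swap₂ c d (p 0) (p 1)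
    where swap₂ : ∀ c d x y → d * x + c * (x + d * y) ≡ c * x + d * (x + c * y)
          swap₂ = solve-∀
  mulLin-comm c d p (suc (suc k)) = swap₃ c d (p k) (p (suc k)) (p (suc (suc k)))
    where swap₃ : ∀ c d x y z → (x + d * y) + c * (y + d * z) ≡ (x + c * y) + d * (y + c * z)
          swap₃ = solve-∀

  rising : ℤ → ℕ → Poly
  rising a zero    = one
  rising a (suc m) = mulLin (a + + m) (rising a m)

  rising-unfoldˡ : ∀ c m k → rising c (suc m) k ≡ mulLin c (rising (c + 1ℤ) m) k
  rising-unfoldˡ c zero    k = cong (λ d → mulLin d one k) (ℤₚ.+-identityʳ c)
  rising-unfoldˡ c (suc m) k = begin
    mulLin (c + + suc m) (rising c (suc m)) k               ≡⟨ mulLin-cong _ (rising-unfoldˡ c m) k ⟩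
    mulLin (c + + suc m) (mulLin c (rising (c + 1ℤ) m)) k    ≡⟨ mulLin-comm (c + + suc m) c _ k ⟩
    mulLin c (mulLin (c + + suc m) (rising (c + 1ℤ) m)) k
      ≡⟨ mulLin-cong c (λ j → cong (λ d → mulLin d (rising (c + 1ℤ) m) j) (shift-constant (+ m))) k ⟩
    mulLin c (rising (c + 1ℤ) (suc m)) k                    ∎
    where
    open ≡-Reasoning
    shift-constant : ∀ x → c + (1ℤ + x) ≡ (c + 1ℤ) + x
    shift-constant x = sym (ℤₚ.+-assoc c 1ℤ x)

  rising-degree : ∀ a m k → m < k → rising a m k ≡ 0ℤ
  rising-degree a zero    (suc k) _         = refl
  rising-degree a (suc m) (suc k) (s≤s m<k) = begin
    rising a m k + (a + + m) * rising a m (suc k)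
      ≡⟨ cong₂ (λ x y → x + (a + + m) * y) (rising-degree a m k m<k) (rising-degree a m (suc k) (ℕₚ.m<n⇒m<1+n m<k)) ⟩
    0ℤ + (a + + m) * 0ℤ                            ≡⟨ cong (λ x → 0ℤ + x) (ℤₚ.*-zeroʳ (a + + m)) ⟩
    0ℤ                                              ∎
    where open ≡-Reasoning

  stirling-rising : ∀ n k → + s n k ≡ rising 0ℤ n k
  stirling-rising zero    zero    = refl
  stirling-rising zero    (suc k) = refl
  stirling-rising (suc n) zero    = trans (ℤₚ.pos-* n (s n zero)) (cong (+ n *_) (stirling-rising n zero))
  stirling-rising (suc n) (suc k) = trans (ℤₚ.pos-+ (s n k) _)
    (cong₂ _+_ (stirling-rising n k) (trans (ℤₚ.pos-* n _) (cong (+ n *_) (stirling-rising n (suc k)))))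

  ∑ : ℕ → (ℕ → ℤ) → ℤ
  ∑ zero    f = 0ℤ
  ∑ (suc B) f = f 0 + ∑ B (λ j → f (suc j))

  ∑-cong : ∀ B {f g} → (∀ j → f j ≡ g j) → ∑ B f ≡ ∑ B g
  ∑-cong zero    f≗g = refl
  ∑-cong (suc B) f≗g = cong₂ _+_ (f≗g 0) (∑-cong B (λ j → f≗g (suc j)))

  ∑-zero : ∀ B {f} → (∀ j → f j ≡ 0ℤ) → ∑ B f ≡ 0ℤ
  ∑-zero zero    f≗0 = refl
  ∑-zero (suc B) f≗0 = cong₂ _+_ (f≗0 0) (∑-zero B (λ j → f≗0 (suc j)))

  ∑-+ : ∀ B f g → ∑ B (λ j → f j + g j) ≡ ∑ B f + ∑ B g
  ∑-+ zero    f g = refl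
  ∑-+ (suc B) f g = trans (cong (λ x → f 0 + g 0 + x) (∑-+ B _ _)) (interchange (f 0) (g 0) _ _)
    where interchange : ∀ a b c d → a + b + (c + d) ≡ a + c + (b + d)
          interchange = solve-∀

  ∑-*ˡ : ∀ B c f → ∑ B (λ j → c * f j) ≡ c * ∑ B f
  ∑-*ˡ zero    c f = sym (ℤₚ.*-zeroʳ c)
  ∑-*ˡ (suc B) c f = trans (cong (λ x → c * f 0 + x) (∑-*ˡ B c _)) (sym (ℤₚ.*-distribˡ-+ c _ _))

  ∑-∣ : ∀ {d} B f → (∀ j → d ∣ f j) → d ∣ ∑ B f
  ∑-∣ {d} zero    f d∣f = divides 0ℤ (sym (ℤₚ.*-zeroˡ d))
  ∑-∣     (suc B) f d∣f = ∣m∣n⇒∣m+n (d∣f 0) (∑-∣ B _ (d∣f ∘ suc))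

  ∑-single-out : ∀ {d} B f j₀ → j₀ < B → (∀ j → j ≢ j₀ → d ∣ f j) → d ∣ ∑ B f - f j₀
  ∑-single-out {d} (suc B) f zero _ others =
    subst (d ∣_) (cancel (f 0) _) (∑-∣ B _ (λ j → others (suc j) λ ()))
    where cancel : ∀ x y → y ≡ x + y - x
          cancel = solve-∀
  ∑-single-out {d} (suc B) f (suc j₀) (s≤s j₀<B) others =
    subst (d ∣_) (reassociate (f 0) _ _)
      (∣m∣n⇒∣m+n (others 0 λ ())
        (∑-single-out B (f ∘ suc) j₀ j₀<B (λ j j≢j₀ → others (suc j) (j≢j₀ ∘ ℕₚ.suc-injective))))
    where reassociate : ∀ x y z → x + (y - z) ≡ x + y - z
          reassociate = solve-∀

  binomial : ℤ → ℕ → Poly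
  binomial b j k = + (j C k) * b ^ (j ℕ.∸ k)

  binomial-suc : ∀ b j k → binomial b (suc j) k ≡ mulLin b (binomial b j) k
  binomial-suc b j zero    = reorder b (b ^ j)
    where reorder : ∀ b y → 1ℤ * (b * y) ≡ b * (1ℤ * y)
          reorder = solve-∀
  binomial-suc b j (suc k) = begin
    + (suc j C suc k) * b ^ (j ℕ.∸ k)
      ≡⟨ cong (λ c → + c * b ^ (j ℕ.∸ k)) (sym (nCk+nC[k+1]≡[n+1]C[k+1] j k)) ⟩
    + (j C k ℕ.+ j C suc k) * b ^ (j ℕ.∸ k)
      ≡⟨ cong (_* b ^ (j ℕ.∸ k)) (ℤₚ.pos-+ (j C k) _) ⟩
    (+ (j C k) + + (j C suc k)) * b ^ (j ℕ.∸ k)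
      ≡⟨ ℤₚ.*-distribʳ-+ (b ^ (j ℕ.∸ k)) (+ (j C k)) (+ (j C suc k)) ⟩
    binomial b j k + + (j C suc k) * b ^ (j ℕ.∸ k)
      ≡⟨ cong (λ x → binomial b j k + x) (lower-power k) ⟩
    binomial b j k + b * binomial b j (suc k) ∎
    where
    open ≡-Reasoning
    ∸-suc : ∀ j k → k < j → j ℕ.∸ k ≡ suc (j ℕ.∸ suc k)
    ∸-suc (suc j) zero    _         = refl
    ∸-suc (suc j) (suc k) (s≤s k<j) = ∸-suc j k k<j
    -- For k < j one factor b can be pulled out; otherwise C(j,k+1) = 0.
    lower-power : ∀ k → + (j C suc k) * b ^ (j ℕ.∸ k) ≡ b * binomial b j (suc k)
    lower-power k with k ℕ.<? j
    ... | yes k<j rewrite ∸-suc j k k<j = pull b (+ (j C suc k)) (b ^ (j ℕ.∸ suc k))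
      where
      pull : ∀ b x y → x * (b * y) ≡ b * (x * y)
      pull = solve-∀
    ... | no k≮j rewrite k>n⇒nCk≡0 (ℕₚ.≰⇒> k≮j) = vanish b (b ^ (j ℕ.∸ k)) (b ^ (j ℕ.∸ suc k))
      where vanish : ∀ b y z → 0ℤ * y ≡ b * (0ℤ * z)
            vanish = solve-∀

  ∑-mulLin : ∀ B b (f : ℕ → ℤ) (g : ℕ → Poly) k →
    ∑ B (λ j → f j * mulLin b (g j) k) ≡ mulLin b (λ k → ∑ B (λ j → f j * g j k)) k
  ∑-mulLin B b f g zero    = trans (∑-cong B (λ j → swap b (f j) (g j 0))) (∑-*ˡ B b (λ j → f j * g j 0))
    where swap : ∀ b x y → x * (b * y) ≡ b * (x * y)
          swap = solve-∀
  ∑-mulLin B b f g (suc k) = begin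
    ∑ B (λ j → f j * (g j k + b * g j (suc k)))
      ≡⟨ ∑-cong B (λ j → expand b (f j) (g j k) (g j (suc k))) ⟩
    ∑ B (λ j → f j * g j k + b * (f j * g j (suc k)))
      ≡⟨ ∑-+ B (λ j → f j * g j k) (λ j → b * (f j * g j (suc k))) ⟩
    ∑ B (λ j → f j * g j k) + ∑ B (λ j → b * (f j * g j (suc k)))
      ≡⟨ cong (λ x → ∑ B (λ j → f j * g j k) + x) (∑-*ˡ B b (λ j → f j * g j (suc k))) ⟩
    ∑ B (λ j → f j * g j k) + b * ∑ B (λ j → f j * g j (suc k)) ∎
    where
    open ≡-Reasoning
    expand : ∀ b x y z → x * (y + b * z) ≡ x * y + b * (x * z)
    expand = solve-∀

  -- translate b B p = coefficients of p(x + b), for polynomials p of degree < B.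
  translate : ℤ → ℕ → Poly → Poly
  translate b B p k = ∑ B (λ j → p j * binomial b j k)

  translate-one : ∀ b B k → translate b (suc B) one k ≡ one k
  translate-one b B k = trans (cong (λ x → 1ℤ * binomial b 0 k + x) (∑-zero B (λ j → ℤₚ.*-zeroˡ (binomial b (suc j) k)))) (constant k)
    where constant : ∀ k → 1ℤ * binomial b 0 k + 0ℤ ≡ one k
          constant zero    = refl
          constant (suc k) = refl

  -- Translating (x + c) · p: the factor becomes (x + b + c), split as c · p(x+b) + (x + b) · p(x+b).
  translate-mulLin : ∀ b c B p k →
    translate b (suc B) (mulLin c p) k ≡ c * translate b (suc B) p k + mulLin b (translate b B p) k
  translate-mulLin b c B p k = begin
    c * p 0 * T 0 + ∑ B (λ j → (p j + c * p (suc j)) * T (suc j))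
      ≡⟨ cong (λ x → c * p 0 * T 0 + x) (trans (∑-cong B (λ j → expand c (p j) (p (suc j)) (T (suc j)))) (∑-+ B _ _)) ⟩
    c * p 0 * T 0 + (∑ B (λ j → p j * T (suc j)) + ∑ B (λ j → c * (p (suc j) * T (suc j))))
      ≡⟨ cong (λ x → c * p 0 * T 0 + (∑ B (λ j → p j * T (suc j)) + x)) (∑-*ˡ B c _) ⟩
    c * p 0 * T 0 + (∑ B (λ j → p j * T (suc j)) + c * ∑ B (λ j → p (suc j) * T (suc j)))
      ≡⟨ regroup c (p 0) (T 0) (∑ B (λ j → p j * T (suc j))) _ ⟩
    c * translate b (suc B) p k + ∑ B (λ j → p j * T (suc j))
      ≡⟨ cong (λ x → c * translate b (suc B) p k + x) shifted ⟩
    c * translate b (suc B) p k + mulLin b (translate b B p) k ∎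
    where
    open ≡-Reasoning
    T : ℕ → ℤ
    T j = binomial b j k
    expand : ∀ c x y t → (x + c * y) * t ≡ x * t + c * (y * t)
    expand = solve-∀
    regroup : ∀ c x t v w → c * x * t + (v + c * w) ≡ c * (x * t + w) + v
    regroup = solve-∀
    shifted : ∑ B (λ j → p j * T (suc j)) ≡ mulLin b (translate b B p) k
    shifted = begin
      ∑ B (λ j → p j * T (suc j))                        ≡⟨ ∑-cong B (λ j → cong (λ t → p j * t) (binomial-suc b j k)) ⟩
      ∑ B (λ j → p j * mulLin b (binomial b j) k)       ≡⟨ ∑-mulLin B b p (binomial b) k ⟩
      mulLin b (translate b B p) k                       ∎

  mulLin-+ : ∀ c d r k → mulLin (d + c) r k ≡ c * r k + mulLin d r k
  mulLin-+ c d r zero    = distrib c d (r 0)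
    where distrib : ∀ c d x → (d + c) * x ≡ c * x + d * x
          distrib = solve-∀
  mulLin-+ c d r (suc k) = distrib c d (r k) (r (suc k))
    where distrib : ∀ c d x y → x + (d + c) * y ≡ c * y + (x + d * y)
          distrib = solve-∀

  rising-translate : ∀ a b m B → m < B → ∀ k → rising (a + b) m k ≡ translate b B (rising a m) k
  rising-translate a b zero    (suc B) _         k = sym (translate-one b B k)
  rising-translate a b (suc m) (suc B) (s≤s m<B) k = begin
    mulLin (a + b + + m) (rising (a + b) m) k
      ≡⟨ cong (λ c → mulLin c (rising (a + b) m) k) (reorder a b (+ m)) ⟩
    mulLin (b + (a + + m)) (rising (a + b) m) k
      ≡⟨ mulLin-+ (a + + m) b (rising (a + b) m) k ⟩
    (a + + m) * rising (a + b) m k + mulLin b (rising (a + b) m) k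
      ≡⟨ cong₂ (λ x y → (a + + m) * x + y) (rising-translate a b m (suc B) (ℕₚ.m<n⇒m<1+n m<B) k)
                                            (mulLin-cong b (rising-translate a b m B m<B) k) ⟩
    (a + + m) * translate b (suc B) (rising a m) k + mulLin b (translate b B (rising a m)) k
      ≡⟨ sym (translate-mulLin b (a + + m) B (rising a m) k) ⟩
    translate b (suc B) (mulLin (a + + m) (rising a m)) k ∎
    where
    open ≡-Reasoning
    reorder : ∀ a b m → a + b + m ≡ b + (a + m)
    reorder = solve-∀

  IsOdd : Poly → Set
  IsOdd p = ∀ k → p (k ℕ.+ k) ≡ 0ℤ

  -- (x - d)(x + d) · p is odd when p is, since (x - d)(x + d) = x² - d² is even.
  mulLin-pair-odd : ∀ d p → IsOdd p → IsOdd (mulLin (- d) (mulLin d p))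
  mulLin-pair-odd d p p-odd zero    = trans (cong (λ x → - d * (d * x)) (p-odd 0)) (vanish d)
    where vanish : ∀ d → - d * (d * 0ℤ) ≡ 0ℤ
          vanish = solve-∀
  mulLin-pair-odd d p p-odd (suc k) = begin
    mulLin (- d) (mulLin d p) (suc k ℕ.+ suc k)
      ≡⟨ cong (mulLin (- d) (mulLin d p)) (cong suc (ℕₚ.+-suc k k)) ⟩
    p (k ℕ.+ k) + d * p (suc (k ℕ.+ k)) + - d * (p (suc (k ℕ.+ k)) + d * p (suc (suc (k ℕ.+ k))))
      ≡⟨ cong₂ (λ x z → x + d * p (suc (k ℕ.+ k)) + - d * (p (suc (k ℕ.+ k)) + d * z))
               (p-odd k) (trans (cong p (cong suc (sym (ℕₚ.+-suc k k)))) (p-odd (suc k))) ⟩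
    0ℤ + d * y + - d * (y + d * 0ℤ)
      ≡⟨ vanish d y ⟩
    0ℤ ∎
    where
    open ≡-Reasoning
    y = p (suc (k ℕ.+ k))
    vanish : ∀ d y → 0ℤ + d * y + - d * (y + d * 0ℤ) ≡ 0ℤ
    vanish = solve-∀

  -- symmetric h = (x - h)(x - h + 1) ⋯ (x + h) = x ∏_{i=1}^{h} (x² - i²).
  symmetric : ℕ → Poly
  symmetric h = rising (- (+ h)) (suc (h ℕ.+ h))

  symmetric-odd : ∀ h → IsOdd (symmetric h)
  symmetric-odd zero    zero    = refl
  symmetric-odd zero    (suc k) = cong (mulLin 0ℤ one) (cong suc (ℕₚ.+-suc k k))
  symmetric-odd (suc h) k = trans (unfold (k ℕ.+ k)) (mulLin-pair-odd (+ suc h) (symmetric h) (symmetric-odd h) k)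
    where
    open ≡-Reasoning
    unfold : ∀ j → symmetric (suc h) j ≡ mulLin (- (+ suc h)) (mulLin (+ suc h) (symmetric h)) j
    unfold j = begin
      rising (- (+ suc h)) (suc (suc h ℕ.+ suc h)) j
        ≡⟨ cong (λ M → rising (- (+ suc h)) (suc M) j) (cong suc (ℕₚ.+-suc h h)) ⟩
      rising (- (+ suc h)) (suc (suc (suc (h ℕ.+ h)))) j
        ≡⟨ rising-unfoldˡ (- (+ suc h)) (suc (suc (h ℕ.+ h))) j ⟩
      mulLin (- (+ suc h)) (rising (- (+ suc h) + 1ℤ) (suc (suc (h ℕ.+ h)))) j
        ≡⟨ mulLin-cong (- (+ suc h)) (λ i → cong (λ a → rising a (suc (suc (h ℕ.+ h))) i) (-[1+h]+1 h)) j ⟩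
      mulLin (- (+ suc h)) (mulLin (- (+ h) + + suc (h ℕ.+ h)) (symmetric h)) j
        ≡⟨ mulLin-cong (- (+ suc h)) (λ i → cong (λ c → mulLin c (symmetric h) i) (top-factor h)) j ⟩
      mulLin (- (+ suc h)) (mulLin (+ suc h) (symmetric h)) j ∎
      where
      -[1+h]+1 : ∀ h → - (+ suc h) + 1ℤ ≡ - (+ h)
      -[1+h]+1 zero    = refl
      -[1+h]+1 (suc h) = refl
      top-factor : ∀ h → - (+ h) + + suc (h ℕ.+ h) ≡ + suc h
      top-factor h = trans (cong (λ x → - (+ h) + x) (sym (ℤₚ.pos-+ (suc h) h))) (cancel (+ suc h) (+ h))
        where cancel : ∀ x y → - y + (x + y) ≡ x
              cancel = solve-∀

  -- Centring the Stirling product: x(x+1)⋯(x+2h+1) = x · σ(x + h + 1) with σ = symmetric h,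
  -- so s(2h+2, k+1) is the k-th coefficient of σ(x + h + 1).
  stirling-expansion : ∀ h B k → suc (h ℕ.+ h) < B →
    + s (suc (suc (h ℕ.+ h))) (suc k) ≡ translate (+ suc h) B (symmetric h) k
  stirling-expansion h B k M<B = begin
    + s (suc M) (suc k)                       ≡⟨ stirling-rising (suc M) (suc k) ⟩
    rising 0ℤ (suc M) (suc k)                 ≡⟨ rising-unfoldˡ 0ℤ M (suc k) ⟩
    rising 1ℤ M k + 0ℤ * rising 1ℤ M (suc k)  ≡⟨ drop-zero (rising 1ℤ M k) (rising 1ℤ M (suc k)) ⟩
    rising 1ℤ M k                             ≡⟨ cong (λ a → rising a M k) (sym (centre (+ h))) ⟩
    rising (- (+ h) + + suc h) M k            ≡⟨ rising-translate (- (+ h)) (+ suc h) M B M<B k ⟩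
    translate (+ suc h) B (symmetric h) k     ∎
    where
    open ≡-Reasoning
    M = suc (h ℕ.+ h)
    drop-zero : ∀ x y → x + 0ℤ * y ≡ x
    drop-zero = solve-∀
    centre : ∀ y → - y + (1ℤ + y) ≡ 1ℤ
    centre = solve-∀

module TwoAdic where

  open import Data.Nat as ℕ using (ℕ; zero; suc; _≤_)
  import Data.Nat.Properties as ℕₚ
  import Data.Nat.Divisibility as ℕ∣
  open import Data.Integer using (ℤ; +_; _+_; _*_; _-_; -_; _^_; NonZero; ≢-nonZero)
  import Data.Integer as ℤ using (∣_∣)
  import Data.Integer.Properties as ℤₚ
  open import Data.Integer.Divisibility.Signed
    using (_∣_; divides; ∣ᵤ⇒∣; ∣⇒∣ᵤ; ∣-refl; ∣-trans; ∣m∣n⇒∣m+n; ∣m∣n⇒∣m-n; ∣m⇒∣-m; ∣m⇒∣m*n;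
           *-monoˡ-∣; *-monoʳ-∣; *-cancelʳ-∣)
  open import Data.Integer.Tactic.RingSolver using (solve-∀)
  open import Data.Product using (_×_; _,_)
  open import Relation.Nullary using (¬_)
  open import Relation.Binary.PropositionalEquality
  open import Defs using (HasV2)

  pow2 : ℕ → ℤ
  pow2 e = (+ 2) ^ e

  pow-pos : ∀ m e → (+ m) ^ e ≡ + (m ℕ.^ e)
  pow-pos m zero    = refl
  pow-pos m (suc e) = trans (cong (+ m *_) (pow-pos m e)) (sym (ℤₚ.pos-* m (m ℕ.^ e)))

  pow2-mono : ∀ {a b} → a ≤ b → pow2 a ∣ pow2 b
  pow2-mono {a} {b} a≤b = divides (pow2 (b ℕ.∸ a)) (begin
    pow2 b                       ≡⟨ cong pow2 (sym (ℕₚ.m∸n+n≡m a≤b)) ⟩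
    pow2 (b ℕ.∸ a ℕ.+ a)         ≡⟨ ℤₚ.^-distribˡ-+-* (+ 2) (b ℕ.∸ a) a ⟩
    pow2 (b ℕ.∸ a) * pow2 a      ∎)
    where open ≡-Reasoning

  pow2-∣-* : ∀ {a b x y} → pow2 a ∣ x → pow2 b ∣ y → pow2 (a ℕ.+ b) ∣ x * y
  pow2-∣-* {a} {b} {x} {y} a∣x b∣y = subst (_∣ x * y) (sym (ℤₚ.^-distribˡ-+-* (+ 2) a b))
    (∣-trans (*-monoˡ-∣ (pow2 b) a∣x) (*-monoʳ-∣ x b∣y))

  HasVal : ℕ → ℤ → Set
  HasVal e x = pow2 e ∣ x × ¬ pow2 (suc e) ∣ x

  HasV2⇒HasVal : ∀ {m e} → HasV2 m e → HasVal e (+ m)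
  HasV2⇒HasVal {m} {e} (e∣m , ¬e+1∣m) =
    ∣ᵤ⇒∣ (subst (ℕ∣._∣ m) (sym (cong ℤ.∣_∣ (pow-pos 2 e))) e∣m) ,
    λ e+1∣m → ¬e+1∣m (subst (ℕ∣._∣ m) (cong ℤ.∣_∣ (pow-pos 2 (suc e))) (∣⇒∣ᵤ e+1∣m))

  HasVal⇒HasV2 : ∀ {m e} → HasVal e (+ m) → HasV2 m e
  HasVal⇒HasV2 {m} {e} (e∣m , ¬e+1∣m) =
    subst (ℕ∣._∣ m) (cong ℤ.∣_∣ (pow-pos 2 e)) (∣⇒∣ᵤ e∣m) ,
    λ e+1∣m → ¬e+1∣m (∣ᵤ⇒∣ (subst (ℕ∣._∣ m) (sym (cong ℤ.∣_∣ (pow-pos 2 (suc e)))) e+1∣m))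

  HasVal-congruent : ∀ {e x y} → pow2 (suc e) ∣ x - y → HasVal e x → HasVal e y
  HasVal-congruent {e} {x} {y} d∣x-y (e∣x , ¬e+1∣x) =
    subst (pow2 e ∣_) (difference x y) (∣m∣n⇒∣m-n e∣x (∣-trans (pow2-mono (ℕₚ.n≤1+n e)) d∣x-y)) ,
    λ e+1∣y → ¬e+1∣x (subst (pow2 (suc e) ∣_) (restore x y) (∣m∣n⇒∣m+n d∣x-y e+1∣y))
    where
    difference : ∀ x y → x - (x - y) ≡ y
    difference = solve-∀
    restore : ∀ x y → x - y + y ≡ x
    restore = solve-∀

  ∣-diff-sym : ∀ {d x y} → d ∣ x - y → d ∣ y - x
  ∣-diff-sym {d} {x} {y} d∣x-y = subst (d ∣_) (negate x y) (∣m⇒∣-m d∣x-y)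
    where negate : ∀ x y → - (x - y) ≡ y - x
          negate = solve-∀

  HasVal-*odd : ∀ {e x} t → HasVal e x → HasVal e (x * + suc (t ℕ.+ t))
  HasVal-*odd {e} {x} t (e∣x , ¬e+1∣x) =
    ∣m⇒∣m*n _ e∣x ,
    λ e+1∣x·odd → ¬e+1∣x (subst (pow2 (suc e) ∣_) (remove-even x (+ t))
      (∣m∣n⇒∣m-n (subst (λ o → pow2 (suc e) ∣ x * o) odd≡ e+1∣x·odd) (∣m⇒∣m*n (+ t) e+1∣2x)))
    where
    e+1∣2x : pow2 (suc e) ∣ x * + 2
    e+1∣2x = subst (_∣ x * + 2) (ℤₚ.*-comm (pow2 e) (+ 2)) (*-monoˡ-∣ (+ 2) e∣x)
    odd≡ : + suc (t ℕ.+ t) ≡ + 1 + (+ t + + t)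
    odd≡ = trans (ℤₚ.pos-+ 1 (t ℕ.+ t)) (cong (λ y → + 1 + y) (ℤₚ.pos-+ t t))
    remove-even : ∀ x t → x * (+ 1 + (t + t)) - x * + 2 * t ≡ x
    remove-even = solve-∀

  HasVal-*pow2 : ∀ {e x} c → HasVal e x → HasVal (e ℕ.+ c) (x * pow2 c)
  HasVal-*pow2 {e} {x} c (e∣x , ¬e+1∣x) =
    pow2-∣-* {e} {c} e∣x (∣-refl {pow2 c}) ,
    λ e+c+1∣x·2^c → ¬e+1∣x (*-cancelʳ-∣ (pow2 c) {{2^c≢0}}
      (subst (_∣ x * pow2 c) (ℤₚ.^-distribˡ-+-* (+ 2) (suc e) c) e+c+1∣x·2^c))
    where
    2^c≢0 : NonZero (pow2 c)
    2^c≢0 = ≢-nonZero (λ 2^c≡0 → 2≢0 (ℤₚ.i^n≡0⇒i≡0 (+ 2) c 2^c≡0))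
      where 2≢0 : + 2 ≢ + 0
            2≢0 ()

module HypothesisBounds where

  open import Data.Nat using (ℕ; zero; suc; >-nonZero; _+_; _*_; _∸_; _^_; _≤_; _<_; z≤n; s≤s; _/_; _<?_; _≤?_)
  import Data.Nat.Properties as ℕₚ
  open import Data.Nat.DivMod using (m*n/n≡m)
  open import Data.Nat.Divisibility using (_∣_; m∣m*n; ∣-trans; ∣⇒≤; divides)
  open import Data.Nat.Tactic.RingSolver using (solve-∀)
  open import Data.Integer using (+_; _-_) renaming (_+_ to _+ℤ_)
  import Data.Integer.Properties as ℤₚ
  import Data.Integer.Tactic.RingSolver as ℤ-Solver
  open import Data.Product using (Σ; _×_; _,_; proj₁; proj₂)
  open import Data.Sum using (inj₁; inj₂)
  open import Data.Empty using (⊥-elim)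
  open import Relation.Nullary using (yes; no)
  open import Relation.Binary.Definitions using (tri<; tri≈; tri>)
  open import Relation.Binary.PropositionalEquality
  open import Defs

  pow2-∣ : ∀ {a b} → a ≤ b → 2 ^ a ∣ 2 ^ b
  pow2-∣ {a} {b} a≤b = divides (2 ^ (b ∸ a))
    (trans (cong (2 ^_) (sym (ℕₚ.m∸n+n≡m a≤b))) (ℕₚ.^-distribˡ-+-* 2 (b ∸ a) a))

  HasV2-unique : ∀ {x a b} → HasV2 x a → HasV2 x b → a ≡ b
  HasV2-unique {x} {a} {b} (a∣x , ¬a+1∣x) (b∣x , ¬b+1∣x) with ℕₚ.<-cmp a b
  ... | tri< a<b _ _ = ⊥-elim (¬a+1∣x (∣-trans (pow2-∣ a<b) b∣x))
  ... | tri≈ _ a≡b _ = a≡b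
  ... | tri> _ _ b<a = ⊥-elim (¬b+1∣x (∣-trans (pow2-∣ b<a) a∣x))

  HasV2-≤ : ∀ {h b p} → HasV2 h b → 1 ≤ h → h ≤ 2 ^ p → b ≤ p
  HasV2-≤ {h} {b} {p} (b∣h , _) 1≤h h≤2^p with ℕₚ.≤-<-connex b p
  ... | inj₁ b≤p = b≤p
  ... | inj₂ p<b = ⊥-elim (ℕₚ.<⇒≱ (ℕₚ.^-monoʳ-< 2 (s≤s (s≤s z≤n)) p<b)
                                 (ℕₚ.≤-trans (∣⇒≤ {{>-nonZero 1≤h}} b∣h) h≤2^p))

  HasV2-one : HasV2 1 0
  HasV2-one = divides 1 refl , λ { (divides zero ()) ; (divides (suc q) ()) }

  -- s(n, n) = 1: the leading coefficient of x(x+1)⋯(x+n-1).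
  s-diagonal : ∀ n → s n n ≡ 1
  s-diagonal zero    = refl
  s-diagonal (suc n) = trans (cong (_+ n * s n (suc n)) (s-diagonal n))
    (cong suc (trans (cong (n *_) (s-above n (suc n) (ℕₚ.n<1+n n))) (ℕₚ.*-zeroʳ n)))
    where
    s-above : ∀ n k → n < k → s n k ≡ 0
    s-above zero    (suc k) _         = refl
    s-above (suc n) (suc k) (s≤s n<k) =
      trans (cong₂ (λ x y → x + n * y) (s-above n k n<k) (s-above n (suc k) (ℕₚ.m<n⇒m<1+n n<k))) (ℕₚ.*-zeroʳ n)

  dyadic-block : ∀ q i → 1 ≤ i → i < 2 ^ q → Σ ℕ (λ p → 2 ^ p ≤ i × i < 2 ^ suc p × suc p ≤ q)
  dyadic-block zero    i 1≤i i<1 = ⊥-elim (ℕₚ.<⇒≱ i<1 1≤i)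
  dyadic-block (suc q) i 1≤i i<2^q+1 with i <? 2 ^ q
  ... | yes i<2^q = let (p , lower , upper , p<q) = dyadic-block q i 1≤i i<2^q
                    in p , lower , upper , ℕₚ.m≤n⇒m≤1+n p<q
  ... | no  i≮2^q = q , ℕₚ.≮⇒≥ i≮2^q , i<2^q+1 , ℕₚ.≤-refl

  Hypothesis : ℕ → Set
  Hypothesis n = (m k : ℕ) → 2 ≤ m → m ≤ n → 2 ∣ k → 2 ≤ k → k ≤ 2 ^ (m ∸ 1) + 1 →
    Σ ℕ (λ a → Σ ℕ (λ b →
      HasV2 (s (2 ^ n) (2 ^ m ∸ k)) a × HasV2 (k / 2) b ×
      (+ a) ≡ ((((+ (2 ^ n) - + (2 ^ m)) - + ((n ∸ m) * (2 ^ m ∸ 2 * (k / 2)))) +ℤ + m) - + 2) - + b))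

  formula-in-ℕ : ∀ a b c N M X →
    + a ≡ ((((+ N - + M) - + X) +ℤ + (2 + c)) - + 2) - + b → a + M + X + b ≡ N + c
  formula-in-ℕ a b c N M X eq = ℤₚ.+-injective (begin
    + (a + M + X + b)                 ≡⟨ ℤₚ.pos-+ (a + M + X) b ⟩
    + (a + M + X) +ℤ + b              ≡⟨ cong (_+ℤ + b) (ℤₚ.pos-+ (a + M) X) ⟩
    + (a + M) +ℤ + X +ℤ + b           ≡⟨ cong (λ y → y +ℤ + X +ℤ + b) (ℤₚ.pos-+ a M) ⟩
    + a +ℤ + M +ℤ + X +ℤ + b          ≡⟨ cong (λ y → y +ℤ + M +ℤ + X +ℤ + b) eq ⟩
    ((((+ N - + M) - + X) +ℤ + (2 + c)) - + 2) - + b +ℤ + M +ℤ + X +ℤ + b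
                                      ≡⟨ cong (λ y → ((((+ N - + M) - + X) +ℤ y) - + 2) - + b +ℤ + M +ℤ + X +ℤ + b) (ℤₚ.pos-+ 2 c) ⟩
    ((((+ N - + M) - + X) +ℤ (+ 2 +ℤ + c)) - + 2) - + b +ℤ + M +ℤ + X +ℤ + b
                                      ≡⟨ cancel (+ N) (+ M) (+ X) (+ c) (+ 2) (+ b) ⟩
    + N +ℤ + c                        ≡⟨ ℤₚ.pos-+ N c ⟨
    + (N + c)                         ∎)
    where
    open ≡-Reasoning
    cancel : ∀ N M X c t b → ((((N - M) - X) +ℤ (t +ℤ c)) - t) - b +ℤ M +ℤ X +ℤ b ≡ N +ℤ c
    cancel = ℤ-Solver.solve-∀

  -- From now on n = n₁ + 1, N = 2^n and H = 2^n₁ = N/2; a_i denotes v₂(s(N, 2i)).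
  module Gaps (n₁ : ℕ) (hyp : Hypothesis (suc n₁)) where

    N H : ℕ
    N = 2 ^ suc n₁
    H = 2 ^ n₁

    -- i lies in the dyadic block of level p, which is admissible for the hypothesis (m = p + 2 ≤ n).
    InBlock : ℕ → ℕ → Set
    InBlock p i = 2 ^ p ≤ i × i < 2 ^ suc p × suc p ≤ n₁

    -- The hypothesis reads  level p i aᵢ + v₂(2^(p+1) - i) = N + p,  where
    level : ℕ → ℕ → ℕ → ℕ
    level p i a = a + 2 ^ (2 + p) + (n₁ ∸ suc p) * (2 * i)

    -- Since 0 ≤ v₂(2^(p+1) - i) ≤ p, the level is pinned between N and N + p.
    block-valuation : ∀ p i → InBlock p i →
      Σ ℕ (λ a → HasV2 (s N (2 * i)) a × N ≤ level p i a × level p i a ≤ N + p)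
    block-valuation p i (2^p≤i , i<2^p+1 , p<n₁) =
      read (hyp (2 + p) (2 * h) (s≤s (s≤s z≤n)) (s≤s p<n₁) (m∣m*n h) (ℕₚ.*-monoʳ-≤ 2 1≤h)
                (ℕₚ.≤-trans (ℕₚ.*-monoʳ-≤ 2 h≤2^p) (ℕₚ.m≤m+n _ 1)))
      where
      -- The hypothesis is applied with m = p + 2 and k = 2h, where h = 2^(p+1) - i.
      h = 2 ^ suc p ∸ i
      1≤h : 1 ≤ h
      1≤h = ℕₚ.m<n⇒0<n∸m i<2^p+1
      h≤2^p : h ≤ 2 ^ p
      h≤2^p = subst (h ≤_) (trans (cong (λ x → 2 ^ p + x ∸ 2 ^ p) (ℕₚ.+-identityʳ (2 ^ p))) (ℕₚ.m+n∸m≡n (2 ^ p) (2 ^ p)))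
                    (ℕₚ.∸-monoʳ-≤ (2 ^ suc p) 2^p≤i)
      k/2≡h : 2 * h / 2 ≡ h
      k/2≡h = trans (cong (_/ 2) (ℕₚ.*-comm 2 h)) (m*n/n≡m h 2)
      2^m-k≡2i : 2 ^ (2 + p) ∸ 2 * h ≡ 2 * i
      2^m-k≡2i = begin
        2 * 2 ^ suc p ∸ 2 * h          ≡⟨ cong (λ x → 2 * x ∸ 2 * h) (sym (ℕₚ.m∸n+n≡m (ℕₚ.<⇒≤ i<2^p+1))) ⟩
        2 * (h + i) ∸ 2 * h            ≡⟨ cong (_∸ 2 * h) (ℕₚ.*-distribˡ-+ 2 h i) ⟩
        2 * h + 2 * i ∸ 2 * h          ≡⟨ ℕₚ.m+n∸m≡n (2 * h) (2 * i) ⟩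
        2 * i                          ∎
        where open ≡-Reasoning
      read : Σ ℕ (λ a → Σ ℕ (λ b →
               HasV2 (s N (2 ^ (2 + p) ∸ 2 * h)) a × HasV2 (2 * h / 2) b ×
               (+ a) ≡ ((((+ N - + (2 ^ (2 + p))) - + ((n₁ ∸ suc p) * (2 ^ (2 + p) ∸ 2 * (2 * h / 2)))) +ℤ + (2 + p)) - + 2) - + b)) →
             Σ ℕ (λ a → HasV2 (s N (2 * i)) a × N ≤ level p i a × level p i a ≤ N + p)
      read (a , b , v₂-s , v₂-k/2 , formula) = a , subst (λ k → HasV2 (s N k) a) 2^m-k≡2i v₂-s , lower , upper
        where
        b≤p : b ≤ p
        b≤p = HasV2-≤ (subst (λ x → HasV2 x b) k/2≡h v₂-k/2) 1≤h h≤2^p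
        level+b : level p i a + b ≡ N + p
        level+b = formula-in-ℕ a b p N _ _
          (subst (λ x → + a ≡ ((((+ N - + (2 ^ (2 + p))) - + ((n₁ ∸ suc p) * x)) +ℤ + (2 + p)) - + 2) - + b)
                 (trans (cong (λ y → 2 ^ (2 + p) ∸ 2 * y) k/2≡h) 2^m-k≡2i) formula)
        lower : N ≤ level p i a
        lower = ℕₚ.+-cancelʳ-≤ p N (level p i a) (subst (_≤ level p i a + p) level+b (ℕₚ.+-monoʳ-≤ (level p i a) b≤p))
        upper : level p i a ≤ N + p
        upper = subst (level p i a ≤_) level+b (ℕₚ.m≤m+n (level p i a) b)

    block-bounds : ∀ p i a → InBlock p i → HasV2 (s N (2 * i)) a → N ≤ level p i a × level p i a ≤ N + p
    block-bounds p i a blk v = transfer (block-valuation p i blk)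
      where
      transfer : Σ ℕ (λ a₀ → HasV2 (s N (2 * i)) a₀ × N ≤ level p i a₀ × level p i a₀ ≤ N + p) →
                 N ≤ level p i a × level p i a ≤ N + p
      transfer (a₀ , v₀ , bounds) = subst (λ x → N ≤ level p i x × level p i x ≤ N + p) (HasV2-unique {a = a₀} {b = a} v₀ v) bounds

    -- a_i exists for 1 ≤ i ≤ H: inside a block by the hypothesis, and a_H = v₂(s(N, N)) = 0.
    valuation-exists : ∀ i → 1 ≤ i → i ≤ H → Σ ℕ (λ a → HasV2 (s N (2 * i)) a)
    valuation-exists i 1≤i i≤H with i <? H
    ... | yes i<H = let (p , blk) = dyadic-block n₁ i 1≤i i<H in
                    let (a , v , _) = block-valuation p i blk in a , v
    ... | no  i≮H = 0 , subst (λ j → HasV2 (s N (2 * j)) 0) (ℕₚ.≤-antisym (ℕₚ.≮⇒≥ i≮H) i≤H)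
                              (subst (λ x → HasV2 x 0) (sym (s-diagonal N)) HasV2-one)

    -- The lower bound of the block of i also holds at i + 1, even when i + 1 starts a new block.
    lower-next : ∀ p i a′ → InBlock p i → HasV2 (s N (2 * suc i)) a′ → N ≤ level p (suc i) a′
    lower-next p i a′ (2^p≤i , i<2^p+1 , p<n₁) v with suc i <? 2 ^ suc p
    ... | yes i+1<2^p+1 = proj₁ (block-bounds p (suc i) a′ (ℕₚ.m≤n⇒m≤1+n 2^p≤i , i+1<2^p+1 , p<n₁) v)
    ... | no  i+1≮2^p+1 with suc (suc p) ≤? n₁
    ...   | yes p+1<n₁ = subst (N ≤_) next-level≡ (proj₁ (block-bounds (suc p) (suc i) a′ next-block v))
      where
      i+1≡ : suc i ≡ 2 ^ suc p
      i+1≡ = ℕₚ.≤-antisym i<2^p+1 (ℕₚ.≮⇒≥ i+1≮2^p+1)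
      next-block : InBlock (suc p) (suc i)
      next-block = ℕₚ.≤-reflexive (sym i+1≡) ,
                   subst (_< 2 ^ (2 + p)) (sym i+1≡) (ℕₚ.^-monoʳ-< 2 (s≤s (s≤s z≤n)) (ℕₚ.n<1+n (suc p))) ,
                   p+1<n₁
      t′ = n₁ ∸ suc (suc p)
      t≡ : n₁ ∸ suc p ≡ suc t′
      t≡ = ℕₚ.+-∸-assoc 1 p+1<n₁
      M = 2 ^ (2 + p)
      next-level≡ : level (suc p) (suc i) a′ ≡ level p (suc i) a′
      next-level≡ = begin
        a′ + 2 * M + t′ * (2 * suc i)          ≡⟨ cong (λ x → a′ + 2 * M + t′ * (2 * x)) i+1≡ ⟩
        a′ + 2 * M + t′ * M                    ≡⟨ regroup a′ M t′ ⟩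
        a′ + M + suc t′ * M                    ≡⟨ cong₂ (λ t x → a′ + M + t * (2 * x)) (sym t≡) (sym i+1≡) ⟩
        a′ + M + (n₁ ∸ suc p) * (2 * suc i)    ∎
        where
        open ≡-Reasoning
        regroup : ∀ a M t → a + 2 * M + t * M ≡ a + M + (1 + t) * M
        regroup = solve-∀
    ...   | no  p+1≮n₁ = subst (λ q → N ≤ a′ + 2 ^ suc q + (n₁ ∸ suc p) * (2 * suc i)) (sym p+1≡n₁)
                           (ℕₚ.≤-trans (ℕₚ.m≤n+m N a′) (ℕₚ.m≤m+n (a′ + N) _))
      where
      p+1≡n₁ : suc p ≡ n₁
      p+1≡n₁ = ℕₚ.≤-antisym p<n₁ (ℕₚ.≤-pred (ℕₚ.≰⇒> p+1≮n₁))

    gap-arithmetic : ∀ a a′ M t p i → a + M + t * (2 * i) ≤ N + p → N ≤ a′ + M + t * (2 * suc i) →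
                     t + suc p ≡ n₁ → a + 2 ≤ a′ + 2 * n₁
    gap-arithmetic a a′ M t p i upper lower t+p+1≡n₁ = begin
      a + 2                       ≤⟨ ℕₚ.+-monoˡ-≤ 2 a≤ ⟩
      a′ + (2 * t + p) + 2        ≤⟨ ℕₚ.m≤m+n _ p ⟩
      a′ + (2 * t + p) + 2 + p    ≡⟨ double a′ t p ⟩
      a′ + 2 * (t + suc p)        ≡⟨ cong (λ x → a′ + 2 * x) t+p+1≡n₁ ⟩
      a′ + 2 * n₁                 ∎
      where
      open ℕₚ.≤-Reasoning
      double : ∀ a t p → a + (2 * t + p) + 2 + p ≡ a + 2 * (t + (1 + p))
      double = solve-∀
      rearrangeˡ : ∀ a M t i → a + M + t * (2 * i) ≡ a + (M + t * (2 * i))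
      rearrangeˡ = solve-∀
      rearrangeʳ : ∀ a M t i p → a + M + t * (2 * (1 + i)) + p ≡ a + (2 * t + p) + (M + t * (2 * i))
      rearrangeʳ = solve-∀
      a≤ : a ≤ a′ + (2 * t + p)
      a≤ = ℕₚ.+-cancelʳ-≤ (M + t * (2 * i)) a (a′ + (2 * t + p))
             (subst₂ _≤_ (rearrangeˡ a M t i) (rearrangeʳ a′ M t i p) (ℕₚ.≤-trans upper (ℕₚ.+-monoˡ-≤ p lower)))

    gap : ∀ i a a′ → 1 ≤ i → suc i ≤ H → HasV2 (s N (2 * i)) a → HasV2 (s N (2 * suc i)) a′ → a + 2 ≤ a′ + 2 * n₁
    gap i a a′ 1≤i i<H v v′ =
      let (p , blk) = dyadic-block n₁ i 1≤i i<H in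
      gap-arithmetic a a′ (2 ^ (2 + p)) (n₁ ∸ suc p) p i
        (proj₂ (block-bounds p i a blk v)) (lower-next p i a′ blk v′) (ℕₚ.m∸n+n≡m (proj₂ (proj₂ blk)))

    gap-chain : ∀ d i a a′ → 1 ≤ i → i + d ≤ H → HasV2 (s N (2 * i)) a → HasV2 (s N (2 * (i + d))) a′ →
                a + (d + d) ≤ a′ + n₁ * (d + d)
    gap-chain zero    i a a′ _   _     v v′ =
      ℕₚ.≤-reflexive (trans (ℕₚ.+-identityʳ a)
        (trans a≡a′ (sym (trans (cong (λ x → a′ + x) (ℕₚ.*-zeroʳ n₁)) (ℕₚ.+-identityʳ a′)))))
      where a≡a′ = HasV2-unique {a = a} {b = a′} v (subst (λ j → HasV2 (s N (2 * j)) a′) (ℕₚ.+-identityʳ i) v′)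
    gap-chain (suc d) i a a′ 1≤i i+d+1≤H v v′ =
      let (a″ , v″) = valuation-exists (i + d) (ℕₚ.≤-trans 1≤i (ℕₚ.m≤m+n i d)) (ℕₚ.<⇒≤ i+d<H) in
      begin
        a + (suc d + suc d)            ≡⟨ shuffleˡ a d ⟩
        a + (d + d) + 2                ≤⟨ ℕₚ.+-monoˡ-≤ 2 (gap-chain d i a a″ 1≤i (ℕₚ.<⇒≤ i+d<H) v v″) ⟩
        a″ + n₁ * (d + d) + 2          ≡⟨ shuffleᵐ a″ n₁ d ⟩
        a″ + 2 + n₁ * (d + d)          ≤⟨ ℕₚ.+-monoˡ-≤ (n₁ * (d + d))
                                            (gap (i + d) a″ a′ (ℕₚ.≤-trans 1≤i (ℕₚ.m≤m+n i d)) i+d<H v″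
                                                 (subst (λ j → HasV2 (s N (2 * j)) a′) (ℕₚ.+-suc i d) v′)) ⟩
        a′ + 2 * n₁ + n₁ * (d + d)     ≡⟨ shuffleʳ a′ n₁ d ⟩
        a′ + n₁ * (suc d + suc d)      ∎
      where
      open ℕₚ.≤-Reasoning
      i+d<H : suc (i + d) ≤ H
      i+d<H = subst (_≤ H) (ℕₚ.+-suc i d) i+d+1≤H
      shuffleˡ : ∀ a d → a + (suc d + suc d) ≡ a + (d + d) + 2
      shuffleˡ = solve-∀
      shuffleᵐ : ∀ a n d → a + n * (d + d) + 2 ≡ a + 2 + n * (d + d)
      shuffleᵐ = solve-∀
      shuffleʳ : ∀ a n d → a + 2 * n + n * (d + d) ≡ a + n * (suc d + suc d)
      shuffleʳ = solve-∀

module Dominance where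

  open import Data.Nat as ℕ using (ℕ; zero; suc; _≤_; _<_; z≤n; s≤s; _≤?_)
  import Data.Nat.Properties as ℕₚ
  import Data.Nat.Tactic.RingSolver as ℕ-Solver
  open import Data.Nat.Combinatorics using (_C_; nCn≡1; k>n⇒nCk≡0; nCk≡nC[n∸k]; nC1≡n)
  open import Data.Integer using (ℤ; +_; _+_; _*_; _^_; 0ℤ; 1ℤ)
  import Data.Integer.Properties as ℤₚ
  open import Data.Integer.Divisibility.Signed using (_∣_; divides; ∣-trans; ∣-reflexive; ∣n⇒∣m*n)
  open import Data.Integer.Tactic.RingSolver using (solve-∀)
  open import Data.Product using (Σ; _,_; proj₁; proj₂)
  open import Data.Sum using (_⊎_; inj₁; inj₂)
  open import Data.Empty using (⊥-elim)
  open import Relation.Nullary using (yes; no)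
  open import Relation.Binary.Definitions using (tri<; tri≈; tri>)
  open import Relation.Binary.PropositionalEquality
  open import Defs
  open Polynomials
  open TwoAdic
  open HypothesisBounds

  parity : ∀ j → Σ ℕ (λ q → j ≡ q ℕ.+ q ⊎ j ≡ suc (q ℕ.+ q))
  parity zero    = 0 , inj₁ refl
  parity (suc j) with parity j
  ... | q , inj₁ j≡2q   = q , inj₂ (cong suc j≡2q)
  ... | q , inj₂ j≡2q+1 = suc q , inj₁ (trans (cong suc j≡2q+1) (sym (ℕₚ.+-suc (suc q) q)))

  downward-induction : ∀ H (P : ℕ → Set) →
    (∀ l → l < H → (∀ l′ → l < l′ → l′ < H → P l′) → P l) → ∀ l → l < H → P l
  downward-induction H P step l l<H = go H l (ℕₚ.m≤n+m H l) l<H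
    where
    go : ∀ fuel l → H ≤ l ℕ.+ fuel → l < H → P l
    go zero       l H≤l   l<H = ⊥-elim (ℕₚ.<⇒≱ l<H (subst (H ≤_) (ℕₚ.+-identityʳ l) H≤l))
    go (suc fuel) l H≤l+f l<H = step l l<H (λ l′ l<l′ l′<H →
      go fuel l′ (ℕₚ.≤-trans H≤l+f (subst (_≤ l′ ℕ.+ fuel) (sym (ℕₚ.+-suc l fuel)) (ℕₚ.+-monoˡ-≤ fuel l<l′))) l′<H)

  ∣-zero : ∀ {d x} → x ≡ 0ℤ → d ∣ x
  ∣-zero {d} refl = divides 0ℤ (sym (ℤₚ.*-zeroˡ d))

  module Claims (n₁ : ℕ) (hyp : Hypothesis (suc n₁)) where
    open Gaps n₁ hyp

    -- H = H₀ + 1 and N = 2H₀ + 2, the shapes used by the expansion of s(N, ·).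
    H₀ : ℕ
    H₀ = ℕ.pred H
    H≡ : H ≡ suc H₀
    H≡ = sym (ℕₚ.suc-pred H {{ℕₚ.m^n≢0 2 n₁}})
    N≡ : N ≡ suc (suc (H₀ ℕ.+ H₀))
    N≡ = trans (cong (λ x → x ℕ.+ (x ℕ.+ 0)) H≡) (double H₀)
      where double : ∀ h → suc h ℕ.+ (suc h ℕ.+ 0) ≡ suc (suc (h ℕ.+ h))
            double = ℕ-Solver.solve-∀

    -- σ = x ∏_{i=1}^{H-1} (x² - i²), so that x(x+1)⋯(x+N-1) = x · σ(x + H).
    σ : Poly
    σ = symmetric H₀

    -- odd l = 2l + 1; a_l is indexed from 0, so that a_l = v₂(s(N, 2l+2)) sits next to σ_(2l+1).
    odd : ℕ → ℕ
    odd l = suc (l ℕ.+ l)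

    term : ℕ → ℕ → ℤ
    term k j = σ j * binomial (pow2 n₁) j k

    expansion : ∀ k → + s N (suc k) ≡ ∑ N (term k)
    expansion k = begin
      + s N (suc k)                                    ≡⟨ cong (λ M → + s M (suc k)) N≡ ⟩
      + s (suc (suc (H₀ ℕ.+ H₀))) (suc k)              ≡⟨ stirling-expansion H₀ (suc (suc (H₀ ℕ.+ H₀))) k ℕₚ.≤-refl ⟩
      translate (+ suc H₀) (suc (suc (H₀ ℕ.+ H₀))) σ k ≡⟨ cong₂ (λ b B → translate b B σ k) +H≡2^n₁ (sym N≡) ⟩
      ∑ N (term k)                                     ∎
      where
      open ≡-Reasoning
      +H≡2^n₁ : + suc H₀ ≡ pow2 n₁
      +H≡2^n₁ = trans (cong +_ (sym H≡)) (sym (pow-pos 2 n₁))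

    -- Terms that vanish: σ is odd, C(j,k) = 0 for j < k, and σ has degree 2H₀ + 1.
    term-even : ∀ k q → term k (q ℕ.+ q) ≡ 0ℤ
    term-even k q = trans (cong (_* binomial (pow2 n₁) (q ℕ.+ q) k) (symmetric-odd H₀ q))
                          (ℤₚ.*-zeroˡ (binomial (pow2 n₁) (q ℕ.+ q) k))

    term-below : ∀ k j → j < k → term k j ≡ 0ℤ
    term-below k j j<k = trans (cong (λ c → σ j * (+ c * pow2 n₁ ^ (j ℕ.∸ k))) (k>n⇒nCk≡0 j<k))
                               (vanish (σ j) (pow2 n₁ ^ (j ℕ.∸ k)))
      where vanish : ∀ x y → x * (0ℤ * y) ≡ 0ℤ
            vanish = solve-∀

    term-beyond : ∀ k q → H ≤ q → term k (odd q) ≡ 0ℤ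
    term-beyond k q H≤q = trans (cong (_* binomial (pow2 n₁) (odd q) k) (rising-degree _ _ (odd q) degree<))
                                (ℤₚ.*-zeroˡ (binomial (pow2 n₁) (odd q) k))
      where
      H₀<q : H₀ < q
      H₀<q = subst (_≤ q) H≡ H≤q
      degree< : suc (H₀ ℕ.+ H₀) < odd q
      degree< = s≤s (ℕₚ.+-mono-< H₀<q H₀<q)

    term-diagonal : ∀ k → term k k ≡ σ k
    term-diagonal k = trans (cong₂ (λ c e → σ k * (+ c * pow2 n₁ ^ e)) (nCn≡1 k) (ℕₚ.n∸n≡0 k)) (ℤₚ.*-identityʳ (σ k))

    term-subdiagonal : ∀ k → term k (suc k) ≡ σ (suc k) * + suc k * pow2 n₁
    term-subdiagonal k = trans (cong₂ (λ c e → σ (suc k) * (+ c * pow2 n₁ ^ e)) (trans k+1Ck (nC1≡n (suc k))) (ℕₚ.m+n∸n≡m 1 k))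
                               (reorder (σ (suc k)) (+ suc k) (pow2 n₁))
      where
      k+1Ck : suc k C k ≡ suc k C 1
      k+1Ck = trans (nCk≡nC[n∸k] (ℕₚ.n≤1+n k)) (cong (suc k C_) (ℕₚ.m+n∸n≡m 1 k))
      reorder : ∀ x c b → x * (c * (b * 1ℤ)) ≡ x * c * b
      reorder = solve-∀

    -- Since the shift is H = 2^n₁, a term is divisible by 2^(v₂(σ_j) + n₁ (j - k)).
    term-divisible : ∀ k j a′ → HasVal a′ (σ j) → pow2 (a′ ℕ.+ n₁ ℕ.* (j ℕ.∸ k)) ∣ term k j
    term-divisible k j a′ (a′∣σ , _) =
      pow2-∣-* {a′} {n₁ ℕ.* (j ℕ.∸ k)} a′∣σ
        (∣n⇒∣m*n (+ (j C k)) (∣-reflexive (sym (ℤₚ.^-*-assoc (+ 2) n₁ (j ℕ.∸ k)))))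

    CoefficientValuation : ℕ → Set
    CoefficientValuation l = ∀ a → HasV2 (s N (2 ℕ.* suc l)) a → HasVal a (σ (odd l))

    -- A term with j = 2q+1 > 2l+1 ≥ k is divisible by 2^(a_l + 1 + n₁(2l+1-k)):
    -- its valuation is at least a_q + n₁(j - k), and a_l + 2d ≤ a_q + 2n₁d for d = q - l ≥ 1.
    far-term : ∀ l a k q → k ≤ odd l → l < q → q < H → HasV2 (s N (2 ℕ.* suc l)) a → CoefficientValuation q →
               pow2 (suc a ℕ.+ n₁ ℕ.* (odd l ℕ.∸ k)) ∣ term k (odd q)
    far-term l a k q k≤2l+1 l<q q<H v claim-q =
      ∣-trans (pow2-mono exponent≤) (term-divisible k (odd q) a′ (claim-q a′ v′))
      where
      open ℕₚ.≤-Reasoning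
      d = q ℕ.∸ l
      l+d≡q : l ℕ.+ d ≡ q
      l+d≡q = ℕₚ.m+[n∸m]≡n (ℕₚ.<⇒≤ l<q)
      a′v′ = valuation-exists (suc q) (s≤s z≤n) q<H
      a′ = proj₁ a′v′
      v′ = proj₂ a′v′
      chain : a ℕ.+ (d ℕ.+ d) ≤ a′ ℕ.+ n₁ ℕ.* (d ℕ.+ d)
      chain = gap-chain d (suc l) a a′ (s≤s z≤n) (subst (_≤ H) (cong suc (sym l+d≡q)) q<H) v
                (subst (λ i → HasV2 (s N (2 ℕ.* i)) a′) (cong suc (sym l+d≡q)) v′)
      1≤d+d : 1 ≤ d ℕ.+ d
      1≤d+d = ℕₚ.≤-trans (ℕₚ.m<n⇒0<n∸m l<q) (ℕₚ.m≤m+n d d)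
      distance : odd q ℕ.∸ k ≡ (d ℕ.+ d) ℕ.+ (odd l ℕ.∸ k)
      distance = trans (cong (λ x → suc (x ℕ.+ x) ℕ.∸ k) (sym l+d≡q))
                       (trans (cong (ℕ._∸ k) (reorder l d)) (ℕₚ.+-∸-assoc (d ℕ.+ d) k≤2l+1))
        where reorder : ∀ l d → suc (l ℕ.+ d ℕ.+ (l ℕ.+ d)) ≡ d ℕ.+ d ℕ.+ suc (l ℕ.+ l)
              reorder = ℕ-Solver.solve-∀
      exponent≤ : suc a ℕ.+ n₁ ℕ.* (odd l ℕ.∸ k) ≤ a′ ℕ.+ n₁ ℕ.* (odd q ℕ.∸ k)
      exponent≤ = begin
        suc a ℕ.+ n₁ ℕ.* (odd l ℕ.∸ k)
          ≤⟨ ℕₚ.+-monoˡ-≤ _ (subst (_≤ a ℕ.+ (d ℕ.+ d)) (ℕₚ.+-comm a 1) (ℕₚ.+-monoʳ-≤ a 1≤d+d)) ⟩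
        a ℕ.+ (d ℕ.+ d) ℕ.+ n₁ ℕ.* (odd l ℕ.∸ k)                 ≤⟨ ℕₚ.+-monoˡ-≤ _ chain ⟩
        a′ ℕ.+ n₁ ℕ.* (d ℕ.+ d) ℕ.+ n₁ ℕ.* (odd l ℕ.∸ k)         ≡⟨ distribute a′ n₁ (d ℕ.+ d) (odd l ℕ.∸ k) ⟩
        a′ ℕ.+ n₁ ℕ.* ((d ℕ.+ d) ℕ.+ (odd l ℕ.∸ k))              ≡⟨ cong (λ x → a′ ℕ.+ n₁ ℕ.* x) (sym distance) ⟩
        a′ ℕ.+ n₁ ℕ.* (odd q ℕ.∸ k)                               ∎
        where distribute : ∀ a n x y → a ℕ.+ n ℕ.* x ℕ.+ n ℕ.* y ≡ a ℕ.+ n ℕ.* (x ℕ.+ y)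
              distribute = ℕ-Solver.solve-∀

    off-diagonal : ∀ l a k → l ℕ.+ l ≤ k → k ≤ odd l → HasV2 (s N (2 ℕ.* suc l)) a →
      (∀ l′ → l < l′ → l′ < H → CoefficientValuation l′) →
      ∀ j → j ≢ odd l → pow2 (suc a ℕ.+ n₁ ℕ.* (odd l ℕ.∸ k)) ∣ term k j
    off-diagonal l a k 2l≤k k≤2l+1 v above j j≢2l+1 with parity j
    ... | q , inj₁ refl = ∣-zero (term-even k q)
    ... | q , inj₂ refl with ℕₚ.<-cmp q l
    ...   | tri< q<l _ _ = ∣-zero (term-below k (odd q)
                               (ℕₚ.≤-trans (subst (_≤ l ℕ.+ l) (cong suc (ℕₚ.+-suc q q)) (ℕₚ.+-mono-≤ q<l q<l)) 2l≤k))
    ...   | tri≈ _ q≡l _ = ⊥-elim (j≢2l+1 (cong odd q≡l))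
    ...   | tri> _ _ l<q with suc q ≤? H
    ...     | yes q<H = far-term l a k q k≤2l+1 l<q q<H v (above q l<q q<H)
    ...     | no  q≮H = ∣-zero (term-beyond k q (ℕₚ.≤-pred (ℕₚ.≰⇒> q≮H)))

    2[l+1]≡ : ∀ l → 2 ℕ.* suc l ≡ suc (suc (l ℕ.+ l))
    2[l+1]≡ = ℕ-Solver.solve-∀

    odd<N : ∀ l → l < H → odd l < N
    odd<N l l<H = subst (odd l <_) (sym N≡) (s≤s (s≤s (ℕₚ.+-mono-≤ l≤H₀ l≤H₀)))
      where l≤H₀ = ℕₚ.≤-pred (subst (suc l ≤_) H≡ l<H)

    -- Claim A, by downward induction on l: the (2l+1)-th term dominates s(N, 2l+2).
    coefficient-valuation : ∀ l → l < H → CoefficientValuation l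
    coefficient-valuation = downward-induction H CoefficientValuation step
      where
      step : ∀ l → l < H → (∀ l′ → l < l′ → l′ < H → CoefficientValuation l′) → CoefficientValuation l
      step l l<H above a v = subst (HasVal a) (term-diagonal (odd l))
        (HasVal-congruent {a} (∑-single-out N (term (odd l)) (odd l) (odd<N l l<H) others) sum-valuation)
        where
        sum-valuation : HasVal a (∑ N (term (odd l)))
        sum-valuation = subst (HasVal a) (expansion (odd l))
                          (HasV2⇒HasVal {e = a} (subst (λ k → HasV2 (s N k) a) (2[l+1]≡ l) v))
        others : ∀ j → j ≢ odd l → pow2 (suc a) ∣ term (odd l) j
        others j j≢ = subst (λ e → pow2 e ∣ term (odd l) j) (no-distance a)
                        (off-diagonal l a (odd l) (ℕₚ.n≤1+n _) ℕₚ.≤-refl v above j j≢)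
          where no-distance : ∀ a → suc a ℕ.+ n₁ ℕ.* (odd l ℕ.∸ odd l) ≡ suc a
                no-distance a = trans (cong (λ x → suc a ℕ.+ n₁ ℕ.* x) (ℕₚ.n∸n≡0 (odd l)))
                                      (trans (cong (λ x → suc a ℕ.+ x) (ℕₚ.*-zeroʳ n₁)) (ℕₚ.+-identityʳ (suc a)))

    -- Claim B: the (2l+1)-th term, σ_{2l+1} (2l+1) 2^n₁, dominates s(N, 2l+1).
    odd-valuation : ∀ l → l < H → ∀ a → HasV2 (s N (2 ℕ.* suc l)) a → HasV2 (s N (odd l)) (a ℕ.+ n₁)
    odd-valuation l l<H a v =
      HasVal⇒HasV2 {e = a ℕ.+ n₁} (subst (HasVal (a ℕ.+ n₁)) (sym (expansion (l ℕ.+ l)))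
        (HasVal-congruent {a ℕ.+ n₁} (∣-diff-sym {x = ∑ N (term (l ℕ.+ l))} {y = term (l ℕ.+ l) (odd l)}
          (∑-single-out N (term (l ℕ.+ l)) (odd l) (odd<N l l<H) others)) main))
      where
      main : HasVal (a ℕ.+ n₁) (term (l ℕ.+ l) (odd l))
      main = subst (HasVal (a ℕ.+ n₁)) (sym (term-subdiagonal (l ℕ.+ l)))
               (HasVal-*pow2 {a} n₁ (HasVal-*odd {a} l (coefficient-valuation l l<H a v)))
      others : ∀ j → j ≢ odd l → pow2 (suc (a ℕ.+ n₁)) ∣ term (l ℕ.+ l) j
      others j j≢ = subst (λ e → pow2 e ∣ term (l ℕ.+ l) j) one-step
                      (off-diagonal l a (l ℕ.+ l) ℕₚ.≤-refl (ℕₚ.n≤1+n _) v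
                        (λ l′ _ l′<H → coefficient-valuation l′ l′<H) j j≢)
        where one-step : suc a ℕ.+ n₁ ℕ.* (odd l ℕ.∸ (l ℕ.+ l)) ≡ suc (a ℕ.+ n₁)
              one-step = trans (cong (λ x → suc a ℕ.+ n₁ ℕ.* x) (ℕₚ.m+n∸n≡m 1 (l ℕ.+ l)))
                               (cong (λ x → suc a ℕ.+ x) (ℕₚ.*-identityʳ n₁))

open import Defs
open import Data.Nat using (ℕ; suc; _+_; _*_; _∸_; _^_; _≤_; _/_)
open import Data.Nat.Divisibility using (_∣_)
open import Data.Integer using (ℤ; +_; _-_) renaming (_+_ to _+ℤ_)
open import Data.Product using (Σ; _×_)
open import Relation.Binary.PropositionalEquality using (_≡_)
open import Data.Nat using (zero; s≤s; z≤n)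
open import Data.Product using (_,_)
open import Relation.Binary.PropositionalEquality using (refl; sym; cong; subst)
open HypothesisBounds using (module Gaps)
open Dominance using (module Claims)

lemma2p5 : (n : ℕ) → 2 ≤ n →
    ((m k : ℕ) → 2 ≤ m → m ≤ n → 2 ∣ k → 2 ≤ k → k ≤ 2 ^ (m ∸ 1) + 1 →
    Σ ℕ (λ a → Σ ℕ (λ b →
    HasV2 (s (2 ^ n) (2 ^ m ∸ k)) a × HasV2 (k / 2) b ×
    (+ a) ≡ ((((+ (2 ^ n) - + (2 ^ m)) - + ((n ∸ m) * (2 ^ m ∸ 2 * (k / 2)))) +ℤ + m) - + 2) - + b))) →
    (i : ℕ) → 1 ≤ i → i ≤ 2 ^ (n ∸ 1) →
    Σ ℕ (λ a → Σ ℕ (λ b →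
    HasV2 (s (2 ^ n) (2 * i ∸ 1)) a × HasV2 (s (2 ^ n) (2 * i)) b × a ≡ b + (n ∸ 1)))
-- With n = n₁ + 1 and i = l + 1: a_i exists, and the valuation of s(N, 2i-1) is a_i + n₁.
lemma2p5 zero () _ _ _ _
lemma2p5 (suc n₁) _ hyp zero () _
lemma2p5 (suc n₁) _ hyp (suc l) _ i≤H =
  let (a , v) = valuation-exists (suc l) (s≤s z≤n) i≤H in
  a + n₁ , a ,
  subst (λ j → HasV2 (s N j) (a + n₁)) (cong (_∸ 1) (sym (2[l+1]≡ l))) (odd-valuation l i≤H a v) ,
  v , refl
  where
  open Gaps n₁ hyp
  open Claims n₁ hyp
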